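{- Let $n\geq 2$ and let $P_n:=D_0\cup D_1\cup\dots\cup D_{\lceil (n-3)/2\rceil}$. If $P\subset P_n$ with $|P_n\setminus P|=1$, then $P$ is a defining set of $B_n$.
   Context: $B_n=\{(i,j;i+j \bmod n): i,j\in\mathbb{Z}_n\}$ is the addition table of $\mathbb{Z}_n$, as triples (row, column; symbol). For $i\in\mathbb{Z}_n$ the diagonal $D_i$ is $\{(r,r+i;2r+i \bmod n): r\in\mathbb{Z}_n\}$. A defining set of a Latin square $L$ is a subset of $L$ contained in no other Latin square of the same order. -}

module Defs where

open import Level using (0ℓ)
open import Data.Nat using (ℕ; zero; suc; _+_; _∸_; _≤_)
open import Data.Nat.DivMod using (_%_; _/_; m%n<n)
open import Data.Fin using (Fin; toℕ; fromℕ<)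
open import Data.Product using (_×_; _,_; ∃-syntax)
open import Relation.Binary.PropositionalEquality using (_≡_)
open import Relation.Unary using (Pred; _∈_)
open import Function.Definitions using (Injective)

-- A triple (row, column; symbol) of an array of order n.
Cell : ℕ → Set
Cell n = Fin n × Fin n × Fin n

-- n mod n-style reduction (n = 0 never matters since Fin 0 is empty)
modN : ℕ → ℕ → ℕ
modN zero    a = a
modN (suc k) a = a % suc k

Array : ℕ → Set
Array n = Fin n → Fin n → Fin n

-- Latin square: each symbol at most once per row and column (hence exactly once).
IsLatin : (n : ℕ) → Array n → Set
IsLatin n L = (∀ r → Injective _≡_ _≡_ (L r)) × (∀ c → Injective _≡_ _≡_ (λ r → L r c))

triples : (n : ℕ) → Array n → Pred (Cell n) 0ℓ
triples n L (r , c , s) = L r c ≡ s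

B : (n : ℕ) → Array n
B (suc k) r c = fromℕ< (m%n<n (toℕ r + toℕ c) (suc k))

-- Diagonal D_i = {(r, r+i; 2r+i)}  (symbol 2r+i = r + (r+i) mod n).
inD : (n : ℕ) → ℕ → Pred (Cell n) 0ℓ
inD n i (r , c , s) = (toℕ c ≡ modN n (toℕ r + i)) × (s ≡ B n r c)

-- P_n = D_0 ∪ … ∪ D_⌈(n-3)/2⌉ ; for n ≥ 2, ⌈(n-3)/2⌉ = ⌊(n-2)/2⌋.
Pn : (n : ℕ) → Pred (Cell n) 0ℓ
Pn n x = ∃[ i ] (i ≤ (n ∸ 2) / 2 × inD n i x)

IsDefiningSet : (n : ℕ) → Pred (Cell n) 0ℓ → Array n → Set
IsDefiningSet n P L0 =
  (∀ x → x ∈ P → x ∈ triples n L0) ×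
  (∀ (L : Array n) → IsLatin n L → (∀ x → x ∈ P → x ∈ triples n L) →
     ∀ r c → L r c ≡ L0 r c)

{-# OPTIONS --safe #-}
-- Let K = ⌈(n-3)/2⌉ and let L be a Latin square containing P. If L r c = s ≠ B r c, the cells
-- (r, s - r) and (s - c, c), where B holds s, are mismatches as well, and their diagonal indices
-- satisfy i_R + i_C ≡ 2 i_X (mod n). When all three indices exceed K this congruence is an
-- equality, and i_R ≠ i_X, so a mate lies on a lower diagonal; hence if no mismatch lies in P_n,
-- there is none at all. It remains to see that the single missing cell e of P_n agrees with B.
-- Otherwise put s* = L e and sum the congruence over the n cells of L holding s*: every row
-- balances exactly except the row of e, which has an excess of n. This gives 2A = 2X + n, where A
-- and X are sums of diagonal indices along permutations, hence multiples of n: a parity clash.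
module Submission where

open import Defs
open import Level using (0ℓ)
open import Data.Nat using (ℕ; zero; suc; _+_; _*_; _∸_; _≤_; _<_; s≤s; s≤s⁻¹; z<s; _/_; _%_)
open import Data.Nat.Properties
open import Data.Nat.DivMod
  using (m≡m%n+[m/n]*n; m%n<n; m/n≤m; m%n%n≡m%n; %-distribˡ-+; [m+n]%n≡m%n; [m+kn]%n≡m%n; m<n⇒m%n≡m)
open import Data.Nat.Tactic.RingSolver using (solve-∀)
open import Data.Fin as Fin using (Fin; toℕ; fromℕ<; punchIn; punchOut)
open import Data.Fin.Properties as Finₚ using (toℕ<n; toℕ-fromℕ<; toℕ-injective; punchInᵢ≢i)
open import Data.Fin.Permutation using (Permutation; permutation; _⟨$⟩ʳ_)
open import Algebra.Properties.CommutativeMonoid.Sum +-0-commutativeMonoid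
  using (sum; sum-remove; sum-cong-≗; sum-permute; ∑-distrib-+)
open import Data.Product using (_×_; _,_; proj₁; proj₂; ∃-syntax)
open import Data.Sum using (_⊎_; inj₁; inj₂; [_,_]′)
open import Data.Empty using (⊥)
open import Function using (_∘_)
open import Function.Definitions using (Injective)
open import Relation.Binary.Definitions using (tri<; tri≈; tri>)
open import Relation.Binary.PropositionalEquality
open import Relation.Nullary using (¬_; yes; no; contradiction)
open import Relation.Nullary.Decidable using (decidable-stable)
open import Relation.Unary using (Pred; _∈_; _∉_; _⊆_)
open import Relation.Binary.Bundles using (Setoid)
open import Relation.Binary.Structures using (IsEquivalence)
import Relation.Binary.Reasoning.Setoid as SetoidReasoning

injective⇒surjective : ∀ {n} {f : Fin n → Fin n} → Injective _≡_ _≡_ f → ∀ y → ∃[ x ] f x ≡ y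
injective⇒surjective {suc k} {f} f-inj y with Finₚ.any? (λ x → f x Finₚ.≟ y)
... | yes hit = hit
... | no miss = contradiction (Finₚ.injective⇒≤ avoid-y-injective) 1+n≰n
  where
  y∉image : ∀ x → y ≢ f x
  y∉image x y≡fx = miss (x , sym y≡fx)

  avoid-y : Fin (suc k) → Fin k
  avoid-y x = punchOut (y∉image x)

  avoid-y-injective : Injective _≡_ _≡_ avoid-y
  avoid-y-injective {x} {x′} = f-inj ∘ Finₚ.punchOut-injective (y∉image x) (y∉image x′)

sum-differ-at : ∀ {n} (f g : Fin (suc n) → ℕ) (i : Fin (suc n)) {k} →
                f i ≡ k + g i → (∀ j → j ≢ i → f j ≡ g j) → sum f ≡ k + sum g
sum-differ-at f g i {k} fi≡k+gi f≗g-elsewhere = begin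
  sum f                                    ≡⟨ sum-remove f ⟩
  f i + sum (λ j → f (punchIn i j))        ≡⟨ cong₂ _+_ fi≡k+gi (sum-cong-≗ elsewhere) ⟩
  k + g i + sum (λ j → g (punchIn i j))    ≡⟨ +-assoc k (g i) _ ⟩
  k + (g i + sum (λ j → g (punchIn i j)))  ≡⟨ cong (k +_) (sum-remove g) ⟨
  k + sum g                                ∎
  where
  open ≡-Reasoning

  elsewhere : ∀ j → f (punchIn i j) ≡ g (punchIn i j)
  elsewhere j = f≗g-elsewhere (punchIn i j) (punchInᵢ≢i i j)

below-average : ∀ {x y z} → x + y ≡ z + z → x ≢ z → x < z ⊎ y < z
below-average {x} {y} {z} x+y≡z+z x≢z with <-cmp x z
... | tri< x<z _ _ = inj₁ x<z
... | tri≈ _ x≡z _ = contradiction x≡z x≢z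
... | tri> _ _ z<x = inj₂ (≰⇒> (λ z≤y → <-irrefl (sym x+y≡z+z) (+-mono-<-≤ z<x z≤y)))

n≤[n∸2]/2+[n∸2]/2+3 : ∀ n → n ≤ (n ∸ 2) / 2 + (n ∸ 2) / 2 + 3
n≤[n∸2]/2+[n∸2]/2+3 n = begin
  n                          ≤⟨ m≤n+m∸n n 2 ⟩
  2 + k                      ≡⟨ cong (2 +_) (m≡m%n+[m/n]*n k 2) ⟩
  2 + (k % 2 + k / 2 * 2)    ≤⟨ +-monoʳ-≤ 2 (+-monoˡ-≤ (k / 2 * 2) (s≤s⁻¹ (m%n<n k 2))) ⟩
  2 + (1 + k / 2 * 2)        ≡⟨ regroup (k / 2) ⟩
  k / 2 + k / 2 + 3          ∎
  where
  open ≤-Reasoning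

  k : ℕ
  k = n ∸ 2

  regroup : ∀ h → 2 + (1 + h * 2) ≡ h + h + 3
  regroup = solve-∀

x+y<n+[u+v] : ∀ {n K x y u v} → n ≤ K + K + 3 → x < n → y < n → K < u → K < v → x + y < n + (u + v)
x+y<n+[u+v] {n} {K} {x} {y} {u} {v} n≤2K+3 x<n y<n K<u K<v = s≤s⁻¹ (begin
  suc (suc (x + y))          ≡⟨ cong suc (+-suc x y) ⟨
  suc x + suc y              ≤⟨ +-mono-≤ x<n y<n ⟩
  n + n                      ≤⟨ +-monoʳ-≤ n n≤2K+3 ⟩
  n + (K + K + 3)            ≡⟨ regroup n K ⟩
  suc (n + (suc K + suc K))  ≤⟨ s≤s (+-monoʳ-≤ n (+-mono-≤ K<u K<v)) ⟩
  suc (n + (u + v))          ∎)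
  where
  open ≤-Reasoning

  regroup : ∀ n k → n + (k + k + 3) ≡ suc (n + (suc k + suc k))
  regroup = solve-∀

module Residues (m : ℕ) where

  N : ℕ
  N = suc m

  -- A record rather than a synonym for a % N ≡ b % N, so that a and b can be inferred from a ≈ b.
  infix 4 _≈_
  record _≈_ (a b : ℕ) : Set where
    constructor mod-≡
    field
      %-≡ : a % N ≡ b % N

  open _≈_ public

  ≈-isEquivalence : IsEquivalence _≈_
  ≈-isEquivalence = record
    { refl  = mod-≡ refl
    ; sym   = λ a≈b → mod-≡ (sym (%-≡ a≈b))
    ; trans = λ a≈b b≈c → mod-≡ (trans (%-≡ a≈b) (%-≡ b≈c))
    }

  ≈-setoid : Setoid 0ℓ 0ℓ
  ≈-setoid = record { isEquivalence = ≈-isEquivalence }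

  open IsEquivalence ≈-isEquivalence public
    using () renaming (refl to ≈-refl; sym to ≈-sym; trans to ≈-trans; reflexive to ≡⇒≈)

  module ≈-Reasoning = SetoidReasoning ≈-setoid

  %-≈ : ∀ a → a % N ≈ a
  %-≈ a = mod-≡ (m%n%n≡m%n a N)

  +-multiple-≈ : ∀ a k → a + k * N ≈ a
  +-multiple-≈ a k = mod-≡ ([m+kn]%n≡m%n a k N)

  N+-≈ : ∀ a → N + a ≈ a
  N+-≈ a = mod-≡ (trans (cong (_% N) (+-comm N a)) ([m+n]%n≡m%n a N))

  +-cong-≈ : ∀ {a b c d} → a ≈ b → c ≈ d → a + c ≈ b + d
  +-cong-≈ {a} {b} {c} {d} (mod-≡ a≈b) (mod-≡ c≈d) = mod-≡ (begin
    (a + c) % N          ≡⟨ %-distribˡ-+ a c N ⟩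
    (a % N + c % N) % N  ≡⟨ cong₂ (λ x y → (x + y) % N) a≈b c≈d ⟩
    (b % N + d % N) % N  ≡⟨ %-distribˡ-+ b d N ⟨
    (b + d) % N          ∎)
    where open ≡-Reasoning

  -- Adding x * m completes the common summand x to the multiple x * N.
  +-cancelʳ-≈ : ∀ {a b} x → a + x ≈ b + x → a ≈ b
  +-cancelʳ-≈ {a} {b} x a+x≈b+x = begin
    a              ≈⟨ +-multiple-≈ a x ⟨
    a + x * N      ≡⟨ complete a ⟩
    a + x + x * m  ≈⟨ +-cong-≈ a+x≈b+x ≈-refl ⟩
    b + x + x * m  ≡⟨ complete b ⟨
    b + x * N      ≈⟨ +-multiple-≈ b x ⟩
    b              ∎
    where
    open ≈-Reasoning

    complete : ∀ a → a + x * N ≡ a + x + x * m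
    complete a = trans (cong (a +_) (*-suc x m)) (sym (+-assoc a x (x * m)))

  <N-≈⇒≡ : ∀ {a b} → a < N → b < N → a ≈ b → a ≡ b
  <N-≈⇒≡ {a} {b} a<N b<N (mod-≡ a≈b) = begin
    a      ≡⟨ m<n⇒m%n≡m a<N ⟨
    a % N  ≡⟨ a≈b ⟩
    b % N  ≡⟨ m<n⇒m%n≡m b<N ⟩
    b      ∎
    where open ≡-Reasoning

  ≈⇒≡-window : ∀ {a b} → a ≈ b → b ≤ a → a < N + b → a ≡ b
  ≈⇒≡-window {a} {b} a≈b b≤a a<N+b = begin
    a          ≡⟨ a∸b+b≡a ⟨
    a ∸ b + b  ≡⟨ cong (_+ b) gap≡0 ⟩
    b          ∎
    where
    open ≡-Reasoning

    a∸b+b≡a : a ∸ b + b ≡ a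
    a∸b+b≡a = m∸n+n≡m b≤a

    gap<N : a ∸ b < N
    gap<N = +-cancelʳ-< b (a ∸ b) N (subst (_< N + b) (sym a∸b+b≡a) a<N+b)

    gap≡0 : a ∸ b ≡ 0
    gap≡0 = <N-≈⇒≡ gap<N z<s (+-cancelʳ-≈ b (≈-trans (≡⇒≈ a∸b+b≡a) a≈b))

  ≈-exact : ∀ {a b} → a ≈ b → a < N + b → b < N + a → a ≡ b
  ≈-exact {a} {b} a≈b a<N+b b<N+a with ≤-total b a
  ... | inj₁ b≤a = ≈⇒≡-window a≈b b≤a a<N+b
  ... | inj₂ a≤b = sym (≈⇒≡-window (≈-sym a≈b) a≤b b<N+a)

  double≢N+double : ∀ {a b} → a ≈ 0 → b ≈ 0 → a + a ≢ N + (b + b)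
  double≢N+double {a} {b} a≈0 b≈0 a+a≡N+b+b =
    even≢odd p q (*-cancelʳ-≡ (2 * p) (suc (2 * q)) N (begin
      2 * p * N            ≡⟨ twice p N ⟩
      p * N + p * N        ≡⟨ cong₂ _+_ (multiple a≈0) (multiple a≈0) ⟨
      a + a                ≡⟨ a+a≡N+b+b ⟩
      N + (b + b)          ≡⟨ cong₂ (λ x y → N + (x + y)) (multiple b≈0) (multiple b≈0) ⟩
      N + (q * N + q * N)  ≡⟨ twice+1 q N ⟨
      suc (2 * q) * N      ∎))
    where
    open ≡-Reasoning

    p q : ℕ
    p = a / N
    q = b / N

    multiple : ∀ {x} → x ≈ 0 → x ≡ x / N * N
    multiple {x} (mod-≡ x≈0) = trans (m≡m%n+[m/n]*n x N) (cong (_+ x / N * N) x≈0)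

    twice : ∀ p n → 2 * p * n ≡ p * n + p * n
    twice = solve-∀

    twice+1 : ∀ q n → suc (2 * q) * n ≡ n + (q * n + q * n)
    twice+1 = solve-∀

  sum-cong-≈ : ∀ {k} {f g : Fin k → ℕ} → (∀ i → f i ≈ g i) → sum f ≈ sum g
  sum-cong-≈ {zero}  f≈g = ≈-refl
  sum-cong-≈ {suc k} f≈g = +-cong-≈ (f≈g Fin.zero) (sum-cong-≈ (f≈g ∘ Fin.suc))

  module _ {K : ℕ} (N≤2K+3 : N ≤ K + K + 3) where

    far-exact : ∀ {x y z : Fin N} → K < toℕ x → K < toℕ y → K < toℕ z →
                toℕ x + toℕ y ≈ toℕ z + toℕ z → toℕ x + toℕ y ≡ toℕ z + toℕ z
    far-exact {x} {y} {z} K<x K<y K<z x+y≈z+z = ≈-exact x+y≈z+z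
      (x+y<n+[u+v] N≤2K+3 (toℕ<n x) (toℕ<n y) K<z K<z)
      (x+y<n+[u+v] N≤2K+3 (toℕ<n z) (toℕ<n z) K<x K<y)

    near-exact : ∀ {x y z : Fin N} → K < toℕ x → K < toℕ y → toℕ z ≤ K →
                 toℕ x + toℕ y ≈ toℕ z + toℕ z → toℕ x + toℕ y ≡ N + (toℕ z + toℕ z)
    near-exact {x} {y} {z} K<x K<y z≤K x+y≈z+z =
      ≈-exact (≈-trans x+y≈z+z (≈-sym (N+-≈ _))) upper lower
      where
      upper : toℕ x + toℕ y < N + (N + (toℕ z + toℕ z))
      upper = <-≤-trans (+-mono-< (toℕ<n x) (toℕ<n y)) (+-monoʳ-≤ N (m≤m+n N _))

      lower : N + (toℕ z + toℕ z) < N + (toℕ x + toℕ y)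
      lower = +-monoʳ-< N (+-mono-< (≤-<-trans z≤K K<x) (≤-<-trans z≤K K<y))

  infixl 6 _⊖_
  _⊖_ : Fin N → Fin N → Fin N
  s ⊖ r = fromℕ< (m%n<n (toℕ s + (N ∸ toℕ r)) N)

  ⊖-+-≈ : ∀ s r → toℕ (s ⊖ r) + toℕ r ≈ toℕ s
  ⊖-+-≈ s r = begin
    toℕ (s ⊖ r) + toℕ r                ≡⟨ cong (_+ toℕ r) (toℕ-fromℕ< _) ⟩
    (toℕ s + (N ∸ toℕ r)) % N + toℕ r  ≈⟨ +-cong-≈ (%-≈ (toℕ s + (N ∸ toℕ r))) (≈-refl {toℕ r}) ⟩
    toℕ s + (N ∸ toℕ r) + toℕ r        ≡⟨ +-assoc (toℕ s) _ _ ⟩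
    toℕ s + (N ∸ toℕ r + toℕ r)        ≡⟨ cong (toℕ s +_) (m∸n+n≡m (<⇒≤ (toℕ<n r))) ⟩
    toℕ s + N                          ≡⟨ +-comm (toℕ s) N ⟩
    N + toℕ s                          ≈⟨ N+-≈ (toℕ s) ⟩
    toℕ s                              ∎
    where open ≈-Reasoning

  ⊖-unique : ∀ {x r s} → toℕ x + toℕ r ≈ toℕ s → x ≡ s ⊖ r
  ⊖-unique {x} {r} {s} x+r≈s = toℕ-injective (<N-≈⇒≡ (toℕ<n x) (toℕ<n (s ⊖ r))
    (+-cancelʳ-≈ (toℕ r) (≈-trans x+r≈s (≈-sym (⊖-+-≈ s r)))))

module AdditionTable (m : ℕ) where

  open Residues m

  B-≈ : ∀ r c → toℕ (B N r c) ≈ toℕ r + toℕ c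
  B-≈ r c = ≈-trans (≡⇒≈ (toℕ-fromℕ< _)) (%-≈ _)

  ≈⇒B≡ : ∀ r c {s} → toℕ r + toℕ c ≈ toℕ s → B N r c ≡ s
  ≈⇒B≡ r c {s} r+c≈s =
    toℕ-injective (<N-≈⇒≡ (toℕ<n (B N r c)) (toℕ<n s) (≈-trans (B-≈ r c) r+c≈s))

  B≡⇒≈ : ∀ r c {s} → B N r c ≡ s → toℕ r + toℕ c ≈ toℕ s
  B≡⇒≈ r c refl = ≈-sym (B-≈ r c)

  B-⊖ʳ : ∀ r s → B N r (s ⊖ r) ≡ s
  B-⊖ʳ r s = ≈⇒B≡ r (s ⊖ r) (≈-trans (≡⇒≈ (+-comm (toℕ r) _)) (⊖-+-≈ s r))

  B-⊖ˡ : ∀ c s → B N (s ⊖ c) c ≡ s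
  B-⊖ˡ c s = ≈⇒B≡ (s ⊖ c) c (⊖-+-≈ s c)

  B⇒⊖ʳ : ∀ r c {s} → B N r c ≡ s → c ≡ s ⊖ r
  B⇒⊖ʳ r c Brc≡s = ⊖-unique (≈-trans (≡⇒≈ (+-comm (toℕ c) (toℕ r))) (B≡⇒≈ r c Brc≡s))

  B⇒⊖ˡ : ∀ r c {s} → B N r c ≡ s → r ≡ s ⊖ c
  B⇒⊖ˡ r c Brc≡s = ⊖-unique (B≡⇒≈ r c Brc≡s)

  ⊖ʳ⇒B : ∀ r c {s} → s ⊖ r ≡ c → B N r c ≡ s
  ⊖ʳ⇒B r _ {s} refl = B-⊖ʳ r s

  ⊖ˡ⇒B : ∀ r c {s} → s ⊖ c ≡ r → B N r c ≡ s
  ⊖ˡ⇒B _ c {s} refl = B-⊖ˡ c s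

  ⊖-involutive : ∀ s r → s ⊖ (s ⊖ r) ≡ r
  ⊖-involutive s r = sym (B⇒⊖ˡ r (s ⊖ r) (B-⊖ʳ r s))

  diag : Fin N → Fin N → ℕ
  diag r c = toℕ (c ⊖ r)

  diag-injectiveʳ : ∀ r c c′ → diag r c ≡ diag r c′ → c ≡ c′
  diag-injectiveʳ r c c′ eq = begin
    c               ≡⟨ B-⊖ʳ r c ⟨
    B N r (c ⊖ r)   ≡⟨ cong (B N r) (toℕ-injective eq) ⟩
    B N r (c′ ⊖ r)  ≡⟨ B-⊖ʳ r c′ ⟩
    c′              ∎
    where open ≡-Reasoning

  -- Modulo N the three diagonals are s - 2r, 2c - s and c - r.
  diag-mates-≈ : ∀ r c s → diag r (s ⊖ r) + diag (s ⊖ c) c ≈ diag r c + diag r c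
  diag-mates-≈ r c s = +-cancelʳ-≈ (S + (R + R)) (begin
    dR + dC + (S + (R + R))    ≡⟨ shuffle dR dC S R ⟩
    (dR + R + R) + (dC + S)    ≈⟨ +-cong-≈ row-mate column-mate ⟩
    S + (C + C)                ≈⟨ +-cong-≈ (≈-refl {S}) (+-cong-≈ cell cell) ⟨
    S + (dX + R + (dX + R))    ≡⟨ unshuffle dX S R ⟩
    dX + dX + (S + (R + R))    ∎)
    where
    open ≈-Reasoning

    R C S dR dC dX : ℕ
    R = toℕ r
    C = toℕ c
    S = toℕ s
    dR = diag r (s ⊖ r)
    dC = diag (s ⊖ c) c
    dX = diag r c

    row-mate : dR + R + R ≈ S
    row-mate = ≈-trans (+-cong-≈ (⊖-+-≈ (s ⊖ r) r) ≈-refl) (⊖-+-≈ s r)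

    column-mate : dC + S ≈ C + C
    column-mate = begin
      dC + S                  ≈⟨ +-cong-≈ (≈-refl {dC}) (⊖-+-≈ s c) ⟨
      dC + (toℕ (s ⊖ c) + C)  ≡⟨ +-assoc dC _ C ⟨
      dC + toℕ (s ⊖ c) + C    ≈⟨ +-cong-≈ (⊖-+-≈ c (s ⊖ c)) ≈-refl ⟩
      C + C                   ∎

    cell : dX + R ≈ C
    cell = ⊖-+-≈ c r

    shuffle : ∀ a b s r → a + b + (s + (r + r)) ≡ (a + r + r) + (b + s)
    shuffle = solve-∀

    unshuffle : ∀ x s r → s + (x + r + (x + r)) ≡ x + x + (s + (r + r))
    unshuffle = solve-∀

  sum-diag-≈0 : (σ : Permutation N N) → sum (λ r → diag r (σ ⟨$⟩ʳ r)) ≈ 0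
  sum-diag-≈0 σ = +-cancelʳ-≈ (sum (toℕ {N})) (begin
    sum d + sum (toℕ {N})       ≡⟨ ∑-distrib-+ d toℕ ⟨
    sum (λ r → d r + toℕ r)     ≈⟨ sum-cong-≈ (λ r → ⊖-+-≈ (σ ⟨$⟩ʳ r) r) ⟩
    sum (λ r → toℕ (σ ⟨$⟩ʳ r))  ≡⟨ sum-permute toℕ σ ⟨
    sum (toℕ {N})               ∎)
    where
    open ≈-Reasoning

    d : Fin N → ℕ
    d r = diag r (σ ⟨$⟩ʳ r)

  inD⇒diag≡ : ∀ r c {i s} → i < N → inD N i (r , c , s) → diag r c ≡ i
  inD⇒diag≡ r c {i} i<N (c≡r+i , _) = <N-≈⇒≡ (toℕ<n (c ⊖ r)) i<N (+-cancelʳ-≈ (toℕ r) (begin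
    diag r c + toℕ r  ≈⟨ ⊖-+-≈ c r ⟩
    toℕ c             ≡⟨ c≡r+i ⟩
    (toℕ r + i) % N   ≈⟨ %-≈ (toℕ r + i) ⟩
    toℕ r + i         ≡⟨ +-comm (toℕ r) i ⟩
    i + toℕ r         ∎))
    where open ≈-Reasoning

  diag-inD : ∀ r c → inD N (diag r c) (r , c , B N r c)
  diag-inD r c = c≡r+diag , refl
    where
    open ≡-Reasoning

    c≡r+diag : toℕ c ≡ (toℕ r + diag r c) % N
    c≡r+diag = begin
      toℕ c                   ≡⟨ m<n⇒m%n≡m (toℕ<n c) ⟨
      toℕ c % N               ≡⟨ %-≡ (⊖-+-≈ c r) ⟨
      (diag r c + toℕ r) % N  ≡⟨ cong (_% N) (+-comm _ (toℕ r)) ⟩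
      (toℕ r + diag r c) % N  ∎

  Pn⇒diag≤ : ∀ r c {s} → (r , c , s) ∈ Pn N → diag r c ≤ (N ∸ 2) / 2
  Pn⇒diag≤ r c (i , i≤ , on-Di) =
    ≤-trans (≤-reflexive (inD⇒diag≡ r c (≤-<-trans i≤ bound<N) on-Di)) i≤
    where
    bound<N : (N ∸ 2) / 2 < N
    bound<N = s≤s (≤-trans (m/n≤m (m ∸ 1) 2) (m∸n≤m m 1))

  diag≤⇒Pn : ∀ r c → diag r c ≤ (N ∸ 2) / 2 → (r , c , B N r c) ∈ Pn N
  diag≤⇒Pn r c near = diag r c , near , diag-inD r c

module Completion {m : ℕ} (K : ℕ) (N≤2K+3 : suc m ≤ K + K + 3)
                  (L : Array (suc m)) (latin : IsLatin (suc m) L) where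

  open Residues m
  open AdditionTable m

  Agrees : Fin N → Fin N → Set
  Agrees r c = L r c ≡ B N r c

  row-injective : ∀ r → Injective _≡_ _≡_ (L r)
  row-injective = proj₁ latin

  column-injective : ∀ c → Injective _≡_ _≡_ (λ r → L r c)
  column-injective = proj₂ latin

  rowMate-mismatch : ∀ {r c s} → L r c ≡ s → ¬ Agrees r c → ¬ Agrees r (s ⊖ r)
  rowMate-mismatch {r} {c} {s} Lrc≡s bad mate-agrees = bad (trans Lrc≡s (sym (⊖ʳ⇒B r c mate≡c)))
    where
    mate≡c : s ⊖ r ≡ c
    mate≡c = row-injective r (trans (trans mate-agrees (B-⊖ʳ r s)) (sym Lrc≡s))

  columnMate-mismatch : ∀ {r c s} → L r c ≡ s → ¬ Agrees r c → ¬ Agrees (s ⊖ c) c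
  columnMate-mismatch {r} {c} {s} Lrc≡s bad mate-agrees = bad (trans Lrc≡s (sym (⊖ˡ⇒B r c mate≡r)))
    where
    mate≡r : s ⊖ c ≡ r
    mate≡r = column-injective c (trans (trans mate-agrees (B-⊖ˡ c s)) (sym Lrc≡s))

  rowMate-diag≢ : ∀ {r c s} → L r c ≡ s → ¬ Agrees r c → diag r (s ⊖ r) ≢ diag r c
  rowMate-diag≢ {r} {c} {s} Lrc≡s bad same-diag =
    bad (trans Lrc≡s (sym (⊖ʳ⇒B r c (diag-injectiveʳ r (s ⊖ r) c same-diag))))

  module _ (mismatch-far : ∀ {r c} → ¬ Agrees r c → K < diag r c) where

    shorter-mismatch : ∀ {r c} → ¬ Agrees r c →
                       ∃[ r′ ] ∃[ c′ ] ¬ Agrees r′ c′ × diag r′ c′ < diag r c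
    shorter-mismatch {r} {c} bad =
      [ (λ row< → r , s ⊖ r , row-bad , row<) , (λ column< → s ⊖ c , c , column-bad , column<) ]′
      (below-average balanced (rowMate-diag≢ refl bad))
      where
      s : Fin N
      s = L r c

      row-bad : ¬ Agrees r (s ⊖ r)
      row-bad = rowMate-mismatch refl bad

      column-bad : ¬ Agrees (s ⊖ c) c
      column-bad = columnMate-mismatch refl bad

      balanced : diag r (s ⊖ r) + diag (s ⊖ c) c ≡ diag r c + diag r c
      balanced = far-exact N≤2K+3 (mismatch-far row-bad) (mismatch-far column-bad) (mismatch-far bad)
                   (diag-mates-≈ r c s)

    no-mismatch-below : ∀ d {r c} → diag r c < d → ¬ ¬ Agrees r c
    no-mismatch-below (suc d) diag<1+d bad with shorter-mismatch bad
    ... | _ , _ , bad′ , shorter = no-mismatch-below d (<-≤-trans shorter (s≤s⁻¹ diag<1+d)) bad′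

    mismatches-far⇒agrees : ∀ r c → Agrees r c
    mismatches-far⇒agrees r c =
      decidable-stable (L r c Finₚ.≟ B N r c) (no-mismatch-below N (toℕ<n (c ⊖ r)))

  module _ {er ec : Fin N} (hole-near : diag er ec ≤ K)
           (only-hole-near : ∀ {r c} → ¬ Agrees r c → diag r c ≤ K → r ≡ er × c ≡ ec) where

    private module HoleMismatch (hole-bad : ¬ Agrees er ec) where

      s* : Fin N
      s* = L er ec

      far : ∀ {r c} → ¬ Agrees r c → ¬ (r ≡ er × c ≡ ec) → K < diag r c
      far bad not-hole = ≰⇒> (not-hole ∘ only-hole-near bad)

      not-hole : ∀ r c → B N r c ≡ s* → ¬ (r ≡ er × c ≡ ec)
      not-hole _ _ Brc≡s* (refl , refl) = hole-bad (sym Brc≡s*)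

      π : Fin N → Fin N
      π r = proj₁ (injective⇒surjective (row-injective r) s*)

      π-spec : ∀ r → L r (π r) ≡ s*
      π-spec r = proj₂ (injective⇒surjective (row-injective r) s*)

      π⁻¹ : Fin N → Fin N
      π⁻¹ c = proj₁ (injective⇒surjective (column-injective c) s*)

      π⁻¹-spec : ∀ c → L (π⁻¹ c) c ≡ s*
      π⁻¹-spec c = proj₂ (injective⇒surjective (column-injective c) s*)

      πᴾ : Permutation N N
      πᴾ = permutation π π⁻¹
        (λ c → row-injective (π⁻¹ c) (trans (π-spec (π⁻¹ c)) (sym (π⁻¹-spec c))))
        (λ r → column-injective (π r) (trans (π⁻¹-spec (π r)) (sym (π-spec r))))

      ρ : Fin N → Fin N
      ρ r = s* ⊖ r

      ρᴾ : Permutation N N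
      ρᴾ = permutation ρ ρ (⊖-involutive s*) (⊖-involutive s*)

      dX dR dC : Fin N → ℕ
      dX r = diag r (π r)
      dR r = diag r (ρ r)
      dC r = diag (ρ (π r)) (π r)

      mates-far : ∀ r → ¬ Agrees r (π r) → K < dR r × K < dC r
      mates-far r bad =
        far (rowMate-mismatch (π-spec r) bad) (not-hole r (ρ r) (B-⊖ʳ r s*)) ,
        far (columnMate-mismatch (π-spec r) bad) (not-hole (ρ (π r)) (π r) (B-⊖ˡ (π r) s*))

      row-balance : ∀ r → r ≢ er → dR r + dC r ≡ dX r + dX r
      row-balance r r≢er with L r (π r) Finₚ.≟ B N r (π r)
      ... | yes agrees = cong₂ _+_ (cong (diag r) (sym πr≡ρr)) (cong (λ x → diag x (π r)) (sym r≡ρπr))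
        where
        Brπr≡s* : B N r (π r) ≡ s*
        Brπr≡s* = trans (sym agrees) (π-spec r)

        πr≡ρr : π r ≡ ρ r
        πr≡ρr = B⇒⊖ʳ r (π r) Brπr≡s*

        r≡ρπr : r ≡ ρ (π r)
        r≡ρπr = B⇒⊖ˡ r (π r) Brπr≡s*
      ... | no bad = far-exact N≤2K+3 (proj₁ (mates-far r bad)) (proj₂ (mates-far r bad))
                       (far bad (r≢er ∘ proj₁)) (diag-mates-≈ r (π r) s*)

      row-excess : dR er + dC er ≡ N + (dX er + dX er)
      row-excess = near-exact N≤2K+3 (proj₁ (mates-far er bad)) (proj₂ (mates-far er bad))
                     (subst (λ c → diag er c ≤ K) (sym πer≡ec) hole-near) (diag-mates-≈ er (π er) s*)
        where
        πer≡ec : π er ≡ ec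
        πer≡ec = row-injective er (π-spec er)

        bad : ¬ Agrees er (π er)
        bad = subst (λ c → ¬ Agrees er c) (sym πer≡ec) hole-bad

      sum-dC≡sum-dR : sum dC ≡ sum dR
      sum-dC≡sum-dR = begin
        sum dC              ≡⟨ sum-permute h πᴾ ⟨
        sum h               ≡⟨ sum-permute h ρᴾ ⟩
        sum (λ r → h (ρ r)) ≡⟨ sum-cong-≗ (λ r → cong (λ x → diag x (ρ r)) (⊖-involutive s* r)) ⟩
        sum dR              ∎
        where
        open ≡-Reasoning

        h : Fin N → ℕ
        h c = diag (ρ c) c

      balance : sum dR + sum dR ≡ N + (sum dX + sum dX)
      balance = begin
        sum dR + sum dR                ≡⟨ cong (sum dR +_) sum-dC≡sum-dR ⟨
        sum dR + sum dC                ≡⟨ ∑-distrib-+ dR dC ⟨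
        sum (λ r → dR r + dC r)        ≡⟨ sum-differ-at _ _ er {N} row-excess row-balance ⟩
        N + sum (λ r → dX r + dX r)    ≡⟨ cong (N +_) (∑-distrib-+ dX dX) ⟩
        N + (sum dX + sum dX)          ∎
        where open ≡-Reasoning

      impossible : ⊥
      impossible = double≢N+double (sum-diag-≈0 ρᴾ) (sum-diag-≈0 πᴾ) balance

    hole-agrees : Agrees er ec
    hole-agrees = decidable-stable (L er ec Finₚ.≟ B N er ec) HoleMismatch.impossible

    only-hole-near⇒agrees : ∀ r c → Agrees r c
    only-hole-near⇒agrees =
      mismatches-far⇒agrees (λ bad → ≰⇒> (bad ∘ agrees-at-hole ∘ only-hole-near bad))
      where
      agrees-at-hole : ∀ {r c} → r ≡ er × c ≡ ec → Agrees r c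
      agrees-at-hole (refl , refl) = hole-agrees

corollary14 : (n : ℕ) → 2 ≤ n → (P : Pred (Cell n) 0ℓ) → P ⊆ Pn n →
    (∃[ e ] (e ∈ Pn n × e ∉ P × (∀ x → x ∈ Pn n → x ∉ P → x ≡ e))) →
    IsDefiningSet n P (B n)
corollary14 (suc zero) (s≤s ()) _ _ _
corollary14 (suc (suc n)) _ P P⊆Pn ((er , ec , es) , hole∈Pn , _ , only-hole) = P⊆B , completes
  where
  open AdditionTable (suc n)

  P⊆B : ∀ x → x ∈ P → x ∈ triples _ (B _)
  P⊆B _ x∈P = sym (proj₂ (proj₂ (proj₂ (P⊆Pn x∈P))))

  completes : ∀ L → IsLatin _ L → (∀ x → x ∈ P → x ∈ triples _ L) → ∀ r c → L r c ≡ B _ r c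
  completes L latin P⊆L = Completion.only-hole-near⇒agrees _ (n≤[n∸2]/2+[n∸2]/2+3 (suc (suc n))) L latin
    (Pn⇒diag≤ er ec hole∈Pn) only-hole-near
    where
    only-hole-near : ∀ {r c} → L r c ≢ B _ r c → diag r c ≤ n / 2 → r ≡ er × c ≡ ec
    only-hole-near {r} {c} bad near = cong proj₁ r,c,Brc≡hole , cong (proj₁ ∘ proj₂) r,c,Brc≡hole
      where
      r,c,Brc≡hole : (r , c , B _ r c) ≡ (er , ec , es)
      r,c,Brc≡hole = only-hole (r , c , B _ r c) (diag≤⇒Pn r c near) (bad ∘ P⊆L _)
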